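{- Let $n,k$ be positive integers. There exists a non-$2$-DP-colorable $k$-uniform hypergraph on $n$ vertices with $2^{k-1}$ edges if and only if there exists an antipodal $k$-splitting of $Q_2^n$.
   Context: A $k$-uniform hypergraph $G$ has vertex set $V(G)=\{1,\dots,n\}$ and edge set $E(G)$, a set of $k$-element subsets of $V(G)$. For each $e\in E(G)$ let $\varphi_e:e\to\{0,1\}$ and $\overline{\varphi_e}=\varphi_e\oplus1$; let $\Phi=(\varphi_e)_{e\in E(G)}$. A $2$-coloring $f:V(G)\to\{0,1\}$ avoids $\Phi$ if $f|_e\ne\varphi_e$ and $f|_e\ne\overline{\varphi_e}$ for every $e\in E(G)$. $G$ is $2$-DP-colorable if for every such $\Phi$ there is a $2$-coloring avoiding $\Phi$. $Q_2^n=\{0,1\}^n$; an $m$-face is a tuple $a\in\{0,1,*\}^n$ with exactly $m$ entries $*$, identified with $\{x: x_i=a_i$ whenever $a_i\in\{0,1\}\}$; faces are parallel if their sets of $*$-positions coincide; parallel faces $a,b$ are antipodal if $b_i=1-a_i$ whenever $a_i\neq*$. An antipodal $k$-splitting of $Q_2^n$ is a collection of exactly $2^k$ $(n-k)$-faces whose union is $Q_2^n$ and which contains no two distinct parallel non-antipodal faces. -}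

module Defs where

open import Data.Nat using (ℕ; zero; suc; _+_; _∸_; _^_)
open import Data.Bool using (Bool; true; false; not)
open import Data.Maybe using (Maybe; just; nothing)
open import Data.Fin using (Fin)
open import Data.Fin.Subset using (Subset; ∣_∣; _∈_)
open import Data.Vec using (Vec; []; _∷_; lookup)
open import Data.List using (List; length)
open import Data.List.Relation.Unary.All using (All)
open import Data.List.Relation.Unary.Any using (Any)
open import Data.List.Relation.Unary.Unique.Propositional using (Unique)
open import Data.List.Membership.Propositional renaming (_∈_ to _∈L_)
open import Data.Product using (Σ; ∃; _×_)
open import Relation.Binary.PropositionalEquality using (_≡_; _≢_)
open import Relation.Nullary using (¬_)
open import Function.Bundles using (_⇔_)

record UniformHypergraph (n k : ℕ) : Set where
  field
    edges   : List (Subset n)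
    distinct : Unique edges
    uniform : All (λ e → ∣ e ∣ ≡ k) edges

open UniformHypergraph public

numEdges : ∀ {n k} → UniformHypergraph n k → ℕ
numEdges G = length (edges G)

Coloring : ℕ → Set
Coloring n = Fin n → Bool

-- A DP-cover Φ = (φ_e)_e: for each edge e a map φ_e : e → {0,1}.
-- We represent φ_e as a total map Fin n → Bool of which only the values
-- on e are relevant (every φ_e : e → {0,1} arises this way).
Cover : ℕ → Set
Cover n = Subset n → Fin n → Bool

RestrDiffer : ∀ {n} → Subset n → (Fin n → Bool) → (Fin n → Bool) → Set
RestrDiffer {n} e f g = Σ (Fin n) λ i → i ∈ e × f i ≢ g i

Avoids : ∀ {n k} → UniformHypergraph n k → Cover n → Coloring n → Set
Avoids G Φ f =
  All (λ e → RestrDiffer e f (Φ e) × RestrDiffer e f (λ i → not (Φ e i)))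
      (edges G)

DP2Colorable : ∀ {n k} → UniformHypergraph n k → Set
DP2Colorable {n} G = (Φ : Cover n) → ∃ λ (f : Coloring n) → Avoids G Φ f

Point : ℕ → Set
Point n = Vec Bool n

-- Faces: tuples in {0,1,*}^n, with * represented by nothing.
Face : ℕ → Set
Face n = Vec (Maybe Bool) n

numStars : ∀ {n} → Face n → ℕ
numStars [] = 0
numStars (nothing ∷ a) = suc (numStars a)
numStars (just _ ∷ a) = numStars a

_∈F_ : ∀ {n} → Point n → Face n → Set
_∈F_ {n} x a = (i : Fin n) (b : Bool) → lookup a i ≡ just b → lookup x i ≡ b

Parallel : ∀ {n} → Face n → Face n → Set
Parallel {n} a b = (i : Fin n) → (lookup a i ≡ nothing) ⇔ (lookup b i ≡ nothing)

Antipodal : ∀ {n} → Face n → Face n → Set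
Antipodal {n} a b =
  Parallel a b × ((i : Fin n) (c : Bool) → lookup a i ≡ just c → lookup b i ≡ just (not c))

record AntipodalSplitting (n k : ℕ) : Set where
  field
    faces     : List (Face n)
    distinct  : Unique faces
    count     : length faces ≡ 2 ^ k
    dimension : All (λ a → numStars a ≡ n ∸ k) faces
    covers    : (x : Point n) → Any (λ a → x ∈F a) faces
    antipodal : (a b : Face n) → a ∈L faces → b ∈L faces → a ≢ b →
                Parallel a b → Antipodal a b

-- A 2-coloring is a point x of the cube, and it fails to avoid a DP-cover Φ on an edge e exactly
-- when x lies in one of the two antipodal faces that fix φ_e, resp. its complement, on e and leave
-- all other coordinates free. So a non-colorable hypergraph with 2^(k-1) edges yields 2^k faces of
-- dimension n - k covering the cube, and two parallel ones come from the same edge.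
-- Conversely, the faces of an antipodal k-splitting cover each point exactly once, since their
-- volumes add up to 2^n. Summing the character x ↦ (-1)^(Σ xᵢ over the fixed coordinates of a)
-- over this partition, the total is 0 while only a and its opposite face can contribute, so the
-- opposite of every face belongs to the splitting. One face from each antipodal pair gives the
-- 2^(k-1) edges, and the cover is read off from the chosen faces.

module Submission where

open import Defs
open import Data.Nat using (ℕ; _≤_; _∸_; _^_)
open import Data.Product using (∃; _×_)
open import Relation.Binary.PropositionalEquality using (_≡_)
open import Relation.Nullary using (¬_)
open import Function.Bundles using (_⇔_)

open import Algebra.Bundles using (CommutativeSemiring)
open import Data.Bool using (Bool; true; false; not)
import Data.Bool.Properties as Bool
open import Data.Empty using (⊥-elim)
open import Data.Fin using (Fin; zero; suc)
import Data.Fin.Properties as Fin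
open import Data.Fin.Subset using (Subset; inside; outside; ⊤; ∣_∣; _∈_; _∉_; _⊆_; Nonempty)
open import Data.Fin.Subset.Properties using (_∈?_; _⊆?_; ⊆-antisym; p⊂q⇒∣p∣<∣q∣; ∣p∣≡n⇒p≡⊤; nonempty?; Empty-unique; ∣⊥∣≡0)
open import Data.Integer as ℤ using (ℤ; +_; 0ℤ; 1ℤ; -1ℤ)
import Data.Integer.Properties as ℤ
open import Data.List as List using (List; []; _∷_; length; filter)
open import Data.List.Membership.Propositional using (find; lose) renaming (_∈_ to _∈L_)
open import Data.List.Membership.Propositional.Properties using (∈-map⁺; ∈-map⁻; ∈-filter⁺; ∈-filter⁻)
open import Data.List.Membership.Propositional.Properties.WithK using (unique∧set⇒bag)
open import Data.List.Properties using (length-map; filter-some)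
open import Data.List.Relation.Binary.BagAndSetEquality using (_∼[_]_; set; ∼bag⇒↭)
open import Data.List.Relation.Binary.Permutation.Propositional.Properties using (↭-length)
open import Data.List.Relation.Unary.All as All using (All; []; _∷_)
import Data.List.Relation.Unary.All.Properties as All
open import Data.List.Relation.Unary.AllPairs using ([]; _∷_)
open import Data.List.Relation.Unary.Any as Any using (Any; here; there)
open import Data.List.Relation.Unary.Unique.Propositional using (Unique)
open import Data.List.Relation.Unary.Unique.Propositional.Properties using (filter⁺)
import Data.List.Relation.Unary.Unique.Propositional.Properties as Unique
import Data.Maybe as Maybe
open import Data.Maybe using (Maybe; just; nothing; is-just; fromMaybe)
import Data.Maybe.Properties as Maybe
open import Data.Nat as ℕ using (zero; suc; _<_; z≤n; s≤s)
import Data.Nat.Properties as ℕ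
open import Data.Product using (∃₂; _,_; proj₁; proj₂)
open import Data.Sum using (_⊎_; inj₁; inj₂)
open import Data.Vec as Vec using (Vec; []; _∷_; lookup; tabulate; replicate; head; tail)
import Data.Vec.Properties as Vec
open import Function using (_∘_; const; id; case_of_)
open import Function.Bundles using (mk⇔; Equivalence)
open import Relation.Binary.Definitions using (DecidableEquality)
open import Relation.Binary.PropositionalEquality using (refl; sym; trans; cong; cong₂; subst; _≢_; _≗_; module ≡-Reasoning)
open import Relation.Nullary using (Dec; yes; no; ¬?; contradiction)
open import Relation.Nullary.Decidable using (_×-dec_; map′; decidable-stable)
open import Relation.Unary using (Decidable)
open import Relation.Unary.Properties using (∁?)

-- Sums over the cube

module CubeSum {a ℓ} (R : CommutativeSemiring a ℓ) where

  open CommutativeSemiring R hiding (zero)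
    renaming (refl to ≈-refl; sym to ≈-sym; trans to ≈-trans)
  open import Algebra.Properties.CommutativeSemigroup +-commutativeSemigroup using (interchange)

  cubeSum : ∀ n → (Point n → Carrier) → Carrier
  cubeSum zero    f = f []
  cubeSum (suc n) f = cubeSum n (f ∘ (false ∷_)) + cubeSum n (f ∘ (true ∷_))

  cubeSum-cong : ∀ n {f g : Point n → Carrier} → (∀ x → f x ≈ g x) → cubeSum n f ≈ cubeSum n g
  cubeSum-cong zero    f≈g = f≈g []
  cubeSum-cong (suc n) f≈g = +-cong (cubeSum-cong n (f≈g ∘ (false ∷_))) (cubeSum-cong n (f≈g ∘ (true ∷_)))

  cubeSum-0# : ∀ n → cubeSum n (const 0#) ≈ 0#
  cubeSum-0# zero    = ≈-refl
  cubeSum-0# (suc n) = ≈-trans (+-cong (cubeSum-0# n) (cubeSum-0# n)) (+-identityˡ 0#)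

  cubeSum-+ : ∀ n (f g : Point n → Carrier) → cubeSum n (λ x → f x + g x) ≈ cubeSum n f + cubeSum n g
  cubeSum-+ zero    f g = ≈-refl
  cubeSum-+ (suc n) f g = ≈-trans (+-cong (cubeSum-+ n _ _) (cubeSum-+ n _ _)) (interchange _ _ _ _)

  cubeSum-*ˡ : ∀ n s (f : Point n → Carrier) → cubeSum n (λ x → s * f x) ≈ s * cubeSum n f
  cubeSum-*ˡ zero    s f = ≈-refl
  cubeSum-*ˡ (suc n) s f = ≈-trans (+-cong (cubeSum-*ˡ n s _) (cubeSum-*ˡ n s _)) (≈-sym (distribˡ s _ _))

  cubeSum-head : ∀ n (h : Bool → Carrier) (g : Point n → Carrier) →
    cubeSum (suc n) (λ x → h (head x) * g (tail x)) ≈ (h false + h true) * cubeSum n g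
  cubeSum-head n h g = ≈-trans (+-cong (cubeSum-*ˡ n (h false) g) (cubeSum-*ˡ n (h true) g))
                               (≈-sym (distribʳ (cubeSum n g) (h false) (h true)))

  listSum : ∀ {A : Set} → List A → (A → Carrier) → Carrier
  listSum []       f = 0#
  listSum (x ∷ xs) f = f x + listSum xs f

  listSum-cong : ∀ {A : Set} (xs : List A) {f g : A → Carrier} → (∀ x → f x ≈ g x) → listSum xs f ≈ listSum xs g
  listSum-cong []       f≈g = ≈-refl
  listSum-cong (x ∷ xs) f≈g = +-cong (f≈g x) (listSum-cong xs f≈g)

  cubeSum-listSum : ∀ n {A : Set} (xs : List A) (h : A → Point n → Carrier) →
    cubeSum n (λ p → listSum xs (λ x → h x p)) ≈ listSum xs (λ x → cubeSum n (h x))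
  cubeSum-listSum n []       h = cubeSum-0# n
  cubeSum-listSum n (x ∷ xs) h = ≈-trans (cubeSum-+ n (h x) _) (+-congˡ (cubeSum-listSum n xs h))

module ℕΣ = CubeSum ℕ.+-*-commutativeSemiring
module ℤΣ = CubeSum ℤ.+-*-commutativeSemiring

-- Faces

_≟ˢ_ : ∀ {n} → DecidableEquality (Subset n)
_≟ˢ_ = Vec.≡-dec Bool._≟_

_≟ᶠ_ : ∀ {n} → DecidableEquality (Face n)
_≟ᶠ_ = Vec.≡-dec (Maybe.≡-dec Bool._≟_)

lookup-extensional : ∀ {A : Set} {n} {xs ys : Vec A n} → (∀ i → lookup xs i ≡ lookup ys i) → xs ≡ ys
lookup-extensional {xs = xs} {ys} eq = begin
  xs                   ≡⟨ sym (Vec.tabulate∘lookup xs) ⟩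
  tabulate (lookup xs) ≡⟨ Vec.tabulate-cong eq ⟩
  tabulate (lookup ys) ≡⟨ Vec.tabulate∘lookup ys ⟩
  ys                   ∎
  where open ≡-Reasoning

fixed : ∀ {n} → Face n → Subset n
fixed = Vec.map is-just

opposite : ∀ {n} → Face n → Face n
opposite = Vec.map (Maybe.map not)

-- junk value false at the stars
value : ∀ {n} → Face n → Fin n → Bool
value a i = fromMaybe false (lookup a i)

face : ∀ {n} → Subset n → (Fin n → Bool) → Face n
face []            g = []
face (inside ∷ e)  g = just (g zero) ∷ face e (g ∘ suc)
face (outside ∷ e) g = nothing ∷ face e (g ∘ suc)

allStars : ∀ n → Face n
allStars n = replicate n nothing

lookup-fixed : ∀ {n} (a : Face n) i → lookup (fixed a) i ≡ is-just (lookup a i)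
lookup-fixed a i = Vec.lookup-map i is-just a

∈fixed⇒just : ∀ {n} {a : Face n} {i} → i ∈ fixed a → ∃ λ v → lookup a i ≡ just v
∈fixed⇒just {a = a} {i} i∈a with lookup a i | trans (sym (lookup-fixed a i)) (Vec.[]=⇒lookup i∈a)
... | just v  | _ = v , refl
... | nothing | ()

∉fixed⇒nothing : ∀ {n} {a : Face n} {i} → i ∉ fixed a → lookup a i ≡ nothing
∉fixed⇒nothing {a = a} {i} i∉a with lookup a i in a[i]
... | nothing = refl
... | just _  = contradiction (Vec.lookup⇒[]= i (fixed a) (trans (lookup-fixed a i) (cong is-just a[i]))) i∉a

numStars+∣fixed∣ : ∀ {n} (a : Face n) → numStars a ℕ.+ ∣ fixed a ∣ ≡ n
numStars+∣fixed∣ []            = refl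
numStars+∣fixed∣ (nothing ∷ a) = cong suc (numStars+∣fixed∣ a)
numStars+∣fixed∣ (just _ ∷ a)  = trans (ℕ.+-suc (numStars a) _) (cong suc (numStars+∣fixed∣ a))

∣fixed∣≡n∸numStars : ∀ {n} (a : Face n) → ∣ fixed a ∣ ≡ n ∸ numStars a
∣fixed∣≡n∸numStars a = trans (sym (ℕ.m+n∸m≡n (numStars a) ∣ fixed a ∣)) (cong (_∸ numStars a) (numStars+∣fixed∣ a))

numStars≡n∸∣fixed∣ : ∀ {n} (a : Face n) → numStars a ≡ n ∸ ∣ fixed a ∣
numStars≡n∸∣fixed∣ a = trans (sym (ℕ.m+n∸n≡m (numStars a) ∣ fixed a ∣)) (cong (_∸ ∣ fixed a ∣) (numStars+∣fixed∣ a))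

numStars<n⇒just : ∀ {n} {a : Face n} → numStars a < n → ∃₂ λ i v → lookup a i ≡ just v
numStars<n⇒just {a = just v ∷ a}  _         = zero , v , refl
numStars<n⇒just {a = nothing ∷ a} (s≤s s<n) with i , v , a[i] ← numStars<n⇒just {a = a} s<n = suc i , v , a[i]

Parallel⇔fixed≡ : ∀ {n} {a b : Face n} → Parallel a b ⇔ (fixed a ≡ fixed b)
Parallel⇔fixed≡ {a = a} {b} = mk⇔
  (λ par → lookup-extensional λ i → begin
     lookup (fixed a) i    ≡⟨ lookup-fixed a i ⟩
     is-just (lookup a i)  ≡⟨ Equivalence.to (pointwise (lookup a i) (lookup b i)) (par i) ⟩
     is-just (lookup b i)  ≡⟨ sym (lookup-fixed b i) ⟩
     lookup (fixed b) i    ∎)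
  (λ a≡b i → Equivalence.from (pointwise (lookup a i) (lookup b i))
     (trans (sym (lookup-fixed a i)) (trans (cong (λ s → lookup s i) a≡b) (lookup-fixed b i))))
  where
  open ≡-Reasoning
  pointwise : (m m′ : Maybe Bool) → ((m ≡ nothing) ⇔ (m′ ≡ nothing)) ⇔ (is-just m ≡ is-just m′)
  pointwise nothing  nothing  = mk⇔ (λ _ → refl) (λ _ → mk⇔ id id)
  pointwise (just _) (just _) = mk⇔ (λ _ → refl) (λ _ → mk⇔ (λ ()) (λ ()))
  pointwise nothing  (just _) = mk⇔ (λ m⇔m′ → case Equivalence.to m⇔m′ refl of λ ()) (λ ())
  pointwise (just _) nothing  = mk⇔ (λ m⇔m′ → case Equivalence.from m⇔m′ refl of λ ()) (λ ())

fixed-opposite : ∀ {n} (a : Face n) → fixed (opposite a) ≡ fixed a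
fixed-opposite []            = refl
fixed-opposite (nothing ∷ a) = cong (false ∷_) (fixed-opposite a)
fixed-opposite (just _ ∷ a)  = cong (true ∷_) (fixed-opposite a)

opposite-involutive : ∀ {n} (a : Face n) → opposite (opposite a) ≡ a
opposite-involutive []            = refl
opposite-involutive (nothing ∷ a) = cong (nothing ∷_) (opposite-involutive a)
opposite-involutive (just v ∷ a)  = cong₂ _∷_ (cong just (Bool.not-involutive v)) (opposite-involutive a)

lookup-opposite : ∀ {n} (a : Face n) {i v} → lookup a i ≡ just v → lookup (opposite a) i ≡ just (not v)
lookup-opposite a {i} a[i] = trans (Vec.lookup-map i (Maybe.map not) a) (cong (Maybe.map not) a[i])

Antipodal-opposite : ∀ {n} (a : Face n) → Antipodal a (opposite a)
Antipodal-opposite a = Equivalence.from Parallel⇔fixed≡ (sym (fixed-opposite a)) , λ i v → lookup-opposite a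

Antipodal⇒≡opposite : ∀ {n} {a b : Face n} → Antipodal a b → b ≡ opposite a
Antipodal⇒≡opposite {a = a} {b} (par , flip) = lookup-extensional λ i →
  trans (pointwise (lookup a i) (lookup b i) (par i) (flip i)) (sym (Vec.lookup-map i (Maybe.map not) a))
  where
  pointwise : (m m′ : Maybe Bool) → (m ≡ nothing) ⇔ (m′ ≡ nothing) →
              (∀ v → m ≡ just v → m′ ≡ just (not v)) → m′ ≡ Maybe.map not m
  pointwise nothing  m′ m⇔m′ _ = Equivalence.to m⇔m′ refl
  pointwise (just v) m′ _   flip = flip v refl

≢opposite : ∀ {n} {a : Face n} {i v} → lookup a i ≡ just v → a ≢ opposite a
≢opposite {a = a} {i} {v} a[i] a≡ā = Bool.not-¬ refl (Maybe.just-injective (begin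
  just v                  ≡⟨ sym a[i] ⟩
  lookup a i              ≡⟨ cong (λ b → lookup b i) a≡ā ⟩
  lookup (opposite a) i   ≡⟨ lookup-opposite a a[i] ⟩
  just (not v)            ∎))
  where open ≡-Reasoning

fixed-face : ∀ {n} (e : Subset n) g → fixed (face e g) ≡ e
fixed-face []            g = refl
fixed-face (inside ∷ e)  g = cong (true ∷_) (fixed-face e (g ∘ suc))
fixed-face (outside ∷ e) g = cong (false ∷_) (fixed-face e (g ∘ suc))

lookup-face : ∀ {n} {e : Subset n} {i} g → i ∈ e → lookup (face e g) i ≡ just (g i)
lookup-face {e = inside ∷ e}  g Vec.here        = refl
lookup-face {e = inside ∷ e}  g (Vec.there i∈e) = lookup-face (g ∘ suc) i∈e
lookup-face {e = outside ∷ e} g (Vec.there i∈e) = lookup-face (g ∘ suc) i∈e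

opposite-face : ∀ {n} (e : Subset n) g → opposite (face e g) ≡ face e (not ∘ g)
opposite-face []            g = refl
opposite-face (inside ∷ e)  g = cong (_ ∷_) (opposite-face e (g ∘ suc))
opposite-face (outside ∷ e) g = cong (_ ∷_) (opposite-face e (g ∘ suc))

AgreeOn : ∀ {n} → Subset n → (Fin n → Bool) → (Fin n → Bool) → Set
AgreeOn e f g = ∀ {i} → i ∈ e → f i ≡ g i

AgreeOn⇒∈F-face : ∀ {n} (e : Subset n) g (x : Point n) → AgreeOn e (lookup x) g → x ∈F face e g
AgreeOn⇒∈F-face (inside ∷ e)  g (y ∷ x) agree zero    _ refl = agree Vec.here
AgreeOn⇒∈F-face (inside ∷ e)  g (y ∷ x) agree (suc i)        = AgreeOn⇒∈F-face e (g ∘ suc) x (agree ∘ Vec.there) i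
AgreeOn⇒∈F-face (outside ∷ e) g (y ∷ x) agree zero    _ ()
AgreeOn⇒∈F-face (outside ∷ e) g (y ∷ x) agree (suc i)        = AgreeOn⇒∈F-face e (g ∘ suc) x (agree ∘ Vec.there) i

∈F⇒AgreeOn : ∀ {n} {x : Point n} {a} → x ∈F a → AgreeOn (fixed a) (lookup x) (value a)
∈F⇒AgreeOn x∈a {i} i∈a with v , a[i] ← ∈fixed⇒just i∈a = trans (x∈a i v a[i]) (sym (cong (fromMaybe false) a[i]))

∈F⇒AgreeOn-opposite : ∀ {n} {x : Point n} {a} → x ∈F a → AgreeOn (fixed (opposite a)) (lookup x) (not ∘ value (opposite a))
∈F⇒AgreeOn-opposite {x = x} {a} x∈a {i} i∈ā with v , a[i] ← ∈fixed⇒just (subst (i ∈_) (fixed-opposite a) i∈ā) = begin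
  lookup x i                                     ≡⟨ x∈a i v a[i] ⟩
  v                                              ≡⟨ sym (Bool.not-involutive v) ⟩
  not (not v)                                    ≡⟨ cong (not ∘ fromMaybe false) (sym (lookup-opposite a a[i])) ⟩
  not (value (opposite a) i)                     ∎
  where open ≡-Reasoning

∣p∣≡1+k⇒Nonempty : ∀ {n k} {p : Subset n} → ∣ p ∣ ≡ suc k → Nonempty p
∣p∣≡1+k⇒Nonempty {n} {p = p} size with nonempty? p
... | yes p≢∅ = p≢∅
... | no p≡∅  = contradiction (trans (sym size) (trans (cong ∣_∣ (Empty-unique p≡∅)) (∣⊥∣≡0 n))) λ ()

⊈⇒∃∈∉ : ∀ {n} {p q : Subset n} → ¬ (p ⊆ q) → ∃ λ i → i ∈ p × i ∉ q
⊈⇒∃∈∉ {p = p} {q} p⊈q with Fin.any? (λ i → (i ∈? p) ×-dec ¬? (i ∈? q))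
... | yes witness = witness
... | no ¬witness = contradiction (λ {i} i∈p → decidable-stable (i ∈? q) (λ i∉q → ¬witness (i , i∈p , i∉q))) p⊈q

∣p∣≡∣q∣⇒∃∈∉ : ∀ {n} {p q : Subset n} → ∣ p ∣ ≡ ∣ q ∣ → p ≢ q → ∃ λ i → i ∈ p × i ∉ q
∣p∣≡∣q∣⇒∃∈∉ {p = p} {q} size p≢q with p ⊆? q
... | no p⊈q = ⊈⇒∃∈∉ p⊈q
... | yes p⊆q with q ⊆? p
...   | yes q⊆p = contradiction (⊆-antisym p⊆q q⊆p) p≢q
...   | no q⊈p  = contradiction size (ℕ.<⇒≢ (p⊂q⇒∣p∣<∣q∣ (p⊆q , ⊈⇒∃∈∉ q⊈p)))

-- From a non-colorable hypergraph to a splitting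

restrDiffer? : ∀ {n} (e : Subset n) f g → Dec (RestrDiffer e f g)
restrDiffer? e f g = Fin.any? λ i → (i ∈? e) ×-dec ¬? (f i Bool.≟ g i)

AgreeOn⇒¬RestrDiffer : ∀ {n} {e : Subset n} {f g} → AgreeOn e f g → ¬ RestrDiffer e f g
AgreeOn⇒¬RestrDiffer agree (i , i∈e , fi≢gi) = fi≢gi (agree i∈e)

¬RestrDiffer⇒AgreeOn : ∀ {n} {e : Subset n} {f g} → ¬ RestrDiffer e f g → AgreeOn e f g
¬RestrDiffer⇒AgreeOn {f = f} {g} ¬differ {i} i∈e =
  decidable-stable (f i Bool.≟ g i) (λ fi≢gi → ¬differ (i , i∈e , fi≢gi))

RestrDiffer-resp : ∀ {n} {e : Subset n} {f g h} → g ≗ h → RestrDiffer e f g → RestrDiffer e f h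
RestrDiffer-resp g≗h (i , i∈e , fi≢gi) = i , i∈e , λ fi≡hi → fi≢gi (trans fi≡hi (sym (g≗h i)))

avoids? : ∀ {n k} (G : UniformHypergraph n k) Φ f → Dec (Avoids G Φ f)
avoids? G Φ f = All.all? (λ e → restrDiffer? e f (Φ e) ×-dec restrDiffer? e f (not ∘ Φ e)) (edges G)

Avoids-resp : ∀ {n k} (G : UniformHypergraph n k) {Φ Ψ f} →
  (∀ {e} → e ∈L edges G → Φ e ≗ Ψ e) → Avoids G Φ f → Avoids G Ψ f
Avoids-resp G Φ≗Ψ avoids = All.tabulate λ e∈G → let differ , differ′ = All.lookup avoids e∈G in
  RestrDiffer-resp (Φ≗Ψ e∈G) differ , RestrDiffer-resp (cong not ∘ Φ≗Ψ e∈G) differ′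

¬Avoids⇒monochromatic : ∀ {n k} (G : UniformHypergraph n k) {Φ f} → ¬ Avoids G Φ f →
  Any (λ e → AgreeOn e f (Φ e) ⊎ AgreeOn e f (not ∘ Φ e)) (edges G)
¬Avoids⇒monochromatic G {Φ} {f} ¬avoids =
  Any.map monochromatic (All.¬All⇒Any¬ (λ e → restrDiffer? e f (Φ e) ×-dec restrDiffer? e f (not ∘ Φ e)) (edges G) ¬avoids)
  where
  monochromatic : ∀ {e} → ¬ (RestrDiffer e f (Φ e) × RestrDiffer e f (not ∘ Φ e)) → AgreeOn e f (Φ e) ⊎ AgreeOn e f (not ∘ Φ e)
  monochromatic {e} ¬both with restrDiffer? e f (Φ e)
  ... | yes differ = inj₂ (¬RestrDiffer⇒AgreeOn (λ differ′ → ¬both (differ , differ′)))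
  ... | no ¬differ = inj₁ (¬RestrDiffer⇒AgreeOn ¬differ)

Searchable : Set → Set₁
Searchable A = ∀ {P : A → Set} → Decidable P → Dec (∃ P)

searchable-Bool : Searchable Bool
searchable-Bool P? with P? false | P? true
... | yes p  | _      = yes (false , p)
... | no _   | yes p  = yes (true , p)
... | no ¬p₀ | no ¬p₁ = no λ { (false , p) → ¬p₀ p ; (true , p) → ¬p₁ p }

searchable-Vec : ∀ {A} → Searchable A → ∀ {n} → Searchable (Vec A n)
searchable-Vec search {zero}  P? = map′ ([] ,_) (λ { ([] , p) → p }) (P? [])
searchable-Vec search {suc n} P? =
  map′ (λ (x , xs , p) → x ∷ xs , p) (λ { (x ∷ xs , p) → x , xs , p })
       (search λ x → searchable-Vec search λ xs → P? (x ∷ xs))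

searchable-Point : ∀ {n} → Searchable (Point n)
searchable-Point = searchable-Vec searchable-Bool

coverOn : ∀ {n} (es : List (Subset n)) → Vec (Point n) (length es) → Cover n
coverOn []        []       e = const false
coverOn (e′ ∷ es) (x ∷ xs) e with e ≟ˢ e′
... | yes _ = lookup x
... | no _  = coverOn es xs e

restrictCover : ∀ {n} (es : List (Subset n)) → Cover n → Vec (Point n) (length es)
restrictCover []       Φ = []
restrictCover (e ∷ es) Φ = tabulate (Φ e) ∷ restrictCover es Φ

coverOn-restrictCover : ∀ {n} (es : List (Subset n)) Φ {e} → e ∈L es → coverOn es (restrictCover es Φ) e ≗ Φ e
coverOn-restrictCover (e′ ∷ es) Φ {e} e∈es i with e ≟ˢ e′ | e∈es
... | yes refl | _          = Vec.lookup∘tabulate (Φ e) i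
... | no e≢e′  | here e≡e′  = contradiction e≡e′ e≢e′
... | no _     | there e∈es = coverOn-restrictCover es Φ e∈es i

-- Avoidance depends on Φ only through its values on the finitely many edges,
-- so a witness of non-colorability can be found by exhaustive search.
blockingCover : ∀ {n k} (G : UniformHypergraph n k) → ¬ DP2Colorable G →
  ∃ λ (Φ : Cover n) → ∀ (x : Point n) → ¬ Avoids G Φ (lookup x)
blockingCover G ¬colorable
  with searchable-Vec searchable-Point (λ xs →
         ¬? (searchable-Point (λ x → avoids? G (coverOn (edges G) xs) (lookup x))))
... | yes (xs , unavoidable) = coverOn (edges G) xs , λ x avoids → unavoidable (x , avoids)
... | no ¬blocking = ⊥-elim (¬colorable colorable)
  where
  colorable : DP2Colorable G
  colorable Φ with searchable-Point (λ x → avoids? G (coverOn (edges G) (restrictCover (edges G) Φ)) (lookup x))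
  ... | yes (x , avoids) = lookup x , Avoids-resp G (coverOn-restrictCover (edges G) Φ) avoids
  ... | no ¬avoids = ⊥-elim (¬blocking (restrictCover (edges G) Φ , ¬avoids))

edgeFaces : ∀ {n} → Cover n → List (Subset n) → List (Face n)
edgeFaces Φ []       = []
edgeFaces Φ (e ∷ es) = face e (Φ e) ∷ opposite (face e (Φ e)) ∷ edgeFaces Φ es

PairOf : ∀ {n} → Face n → Face n → Set
PairOf a b = b ≡ a ⊎ b ≡ opposite a

fixed-PairOf-face : ∀ {n} {e : Subset n} {g b} → PairOf (face e g) b → fixed b ≡ e
fixed-PairOf-face {e = e} {g} (inj₁ refl) = fixed-face e g
fixed-PairOf-face {e = e} {g} (inj₂ refl) = trans (fixed-opposite (face e g)) (fixed-face e g)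

Antipodal-PairOf : ∀ {n} {a b b′ : Face n} → PairOf a b → PairOf a b′ → b ≢ b′ → Antipodal b b′
Antipodal-PairOf (inj₁ refl) (inj₁ refl) b≢b′ = contradiction refl b≢b′
Antipodal-PairOf {a = a} (inj₁ refl) (inj₂ refl) _ = Antipodal-opposite a
Antipodal-PairOf {a = a} (inj₂ refl) (inj₁ refl) _ =
  subst (Antipodal (opposite a)) (opposite-involutive a) (Antipodal-opposite (opposite a))
Antipodal-PairOf (inj₂ refl) (inj₂ refl) b≢b′ = contradiction refl b≢b′

∈-edgeFaces⁻ : ∀ {n} {Φ : Cover n} es {b} → b ∈L edgeFaces Φ es → ∃ λ e → e ∈L es × PairOf (face e (Φ e)) b
∈-edgeFaces⁻ (e ∷ es) (here b≡a)         = e , here refl , inj₁ b≡a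
∈-edgeFaces⁻ (e ∷ es) (there (here b≡ā)) = e , here refl , inj₂ b≡ā
∈-edgeFaces⁻ (e ∷ es) (there (there b∈)) with e′ , e′∈es , pair ← ∈-edgeFaces⁻ es b∈ = e′ , there e′∈es , pair

fixed-∈-edgeFaces : ∀ {n} {Φ : Cover n} es {b} → b ∈L edgeFaces Φ es → fixed b ∈L es
fixed-∈-edgeFaces es b∈ with e , e∈es , pair ← ∈-edgeFaces⁻ es b∈ = subst (_∈L es) (sym (fixed-PairOf-face pair)) e∈es

length-edgeFaces : ∀ {n} (Φ : Cover n) es → length (edgeFaces Φ es) ≡ 2 ℕ.* length es
length-edgeFaces Φ []       = refl
length-edgeFaces Φ (e ∷ es) = trans (cong (2 ℕ.+_) (length-edgeFaces Φ es)) (sym (ℕ.*-suc 2 (length es)))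

edgeFaces-unique : ∀ {n} (Φ : Cover n) es → Unique es → All Nonempty es → Unique (edgeFaces Φ es)
edgeFaces-unique Φ []       []             []                  = []
edgeFaces-unique Φ (e ∷ es) (e∉es ∷ uniq) ((i , i∈e) ∷ nonempty) =
  (≢opposite (lookup-face (Φ e) i∈e) ∷ apart (fixed-face e (Φ e)))
  ∷ apart (trans (fixed-opposite _) (fixed-face e (Φ e)))
  ∷ edgeFaces-unique Φ es uniq nonempty
  where
  apart : ∀ {a} → fixed a ≡ e → All (a ≢_) (edgeFaces Φ es)
  apart fa≡e = All.tabulate λ b∈ a≡b →
    All.lookup e∉es (subst (_∈L es) (cong fixed (sym a≡b)) (fixed-∈-edgeFaces es b∈)) (sym fa≡e)

edgeFaces-cover : ∀ {n} (Φ : Cover n) es (x : Point n) →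
  Any (λ e → AgreeOn e (lookup x) (Φ e) ⊎ AgreeOn e (lookup x) (not ∘ Φ e)) es → Any (x ∈F_) (edgeFaces Φ es)
edgeFaces-cover Φ (e ∷ es) x (here (inj₁ agree)) = here (AgreeOn⇒∈F-face e (Φ e) x agree)
edgeFaces-cover Φ (e ∷ es) x (here (inj₂ agree)) =
  there (here (subst (x ∈F_) (sym (opposite-face e (Φ e))) (AgreeOn⇒∈F-face e (not ∘ Φ e) x agree)))
edgeFaces-cover Φ (e ∷ es) x (there monochromatic) = there (there (edgeFaces-cover Φ es x monochromatic))

splitting-of-blockingCover : ∀ {n k} (G : UniformHypergraph n k) → 1 ≤ k → numEdges G ≡ 2 ^ (k ∸ 1) →
  (Φ : Cover n) → (∀ x → ¬ Avoids G Φ (lookup x)) → AntipodalSplitting n k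
splitting-of-blockingCover {n} {suc k} G (s≤s z≤n) size Φ blocked = record
  { faces     = F
  ; distinct  = edgeFaces-unique Φ (edges G) (distinct G) (All.map ∣p∣≡1+k⇒Nonempty (uniform G))
  ; count     = trans (length-edgeFaces Φ (edges G)) (cong (2 ℕ.*_) size)
  ; dimension = All.tabulate λ {b} b∈ →
      trans (numStars≡n∸∣fixed∣ b) (cong (n ∸_) (All.lookup (uniform G) (fixed-∈-edgeFaces (edges G) b∈)))
  ; covers    = λ x → edgeFaces-cover Φ (edges G) x (¬Avoids⇒monochromatic G (blocked x))
  ; antipodal = λ b b′ b∈ b′∈ b≢b′ b∥b′ → antipodal b∈ b′∈ b≢b′ (Equivalence.to Parallel⇔fixed≡ b∥b′)
  }
  where
  F = edgeFaces Φ (edges G)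
  antipodal : ∀ {b b′} → b ∈L F → b′ ∈L F → b ≢ b′ → fixed b ≡ fixed b′ → Antipodal b b′
  antipodal b∈ b′∈ b≢b′ same
    with e , _ , pair ← ∈-edgeFaces⁻ (edges G) b∈ | e′ , _ , pair′ ← ∈-edgeFaces⁻ (edges G) b′∈
    with refl ← trans (sym (fixed-PairOf-face pair)) (trans same (fixed-PairOf-face pair′))
    = Antipodal-PairOf pair pair′ b≢b′

-- Exact covers by faces

fits : Maybe Bool → Bool → ℕ
fits nothing      _     = 1
fits (just false) false = 1
fits (just false) true  = 0
fits (just true)  false = 0
fits (just true)  true  = 1

indicator : ∀ {n} → Face n → Point n → ℕ
indicator []      []      = 1
indicator (m ∷ a) (y ∷ x) = fits m y ℕ.* indicator a x

∈F⇒indicator≡1 : ∀ {n} (x : Point n) a → x ∈F a → indicator a x ≡ 1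
∈F⇒indicator≡1 []      []            _   = refl
∈F⇒indicator≡1 (y ∷ x) (nothing ∷ a) x∈a = trans (ℕ.*-identityˡ _) (∈F⇒indicator≡1 x a (x∈a ∘ suc))
∈F⇒indicator≡1 (y ∷ x) (just v ∷ a)  x∈a with refl ← x∈a zero v refl =
  trans (cong (ℕ._* indicator a x) (fits-self y)) (trans (ℕ.*-identityˡ _) (∈F⇒indicator≡1 x a (x∈a ∘ suc)))
  where
  fits-self : ∀ y → fits (just y) y ≡ 1
  fits-self false = refl
  fits-self true  = refl

∈F-allStars : ∀ {n} (x : Point n) → x ∈F allStars n
∈F-allStars x i v stars[i] = contradiction (trans (sym (Vec.lookup-replicate i nothing)) stars[i]) λ ()

numStars-allStars : ∀ n → numStars (allStars n) ≡ n
numStars-allStars zero    = refl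
numStars-allStars (suc n) = cong suc (numStars-allStars n)

cubeSum-indicator : ∀ n (a : Face n) → ℕΣ.cubeSum n (indicator a) ≡ 2 ^ numStars a
cubeSum-indicator zero    []      = refl
cubeSum-indicator (suc n) (m ∷ a) = begin
  ℕΣ.cubeSum (suc n) (indicator (m ∷ a))                          ≡⟨ ℕΣ.cubeSum-head n (fits m) (indicator a) ⟩
  (fits m false ℕ.+ fits m true) ℕ.* ℕΣ.cubeSum n (indicator a)   ≡⟨ cong ((fits m false ℕ.+ fits m true) ℕ.*_) (cubeSum-indicator n a) ⟩
  (fits m false ℕ.+ fits m true) ℕ.* 2 ^ numStars a               ≡⟨ both m ⟩
  2 ^ numStars (m ∷ a)                                            ∎
  where
  open ≡-Reasoning
  both : ∀ m → (fits m false ℕ.+ fits m true) ℕ.* 2 ^ numStars a ≡ 2 ^ numStars (m ∷ a)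
  both nothing      = refl
  both (just false) = ℕ.*-identityˡ _
  both (just true)  = ℕ.*-identityˡ _

cubeSum-mono-≤ : ∀ n {f g : Point n → ℕ} → (∀ x → f x ≤ g x) → ℕΣ.cubeSum n f ≤ ℕΣ.cubeSum n g
cubeSum-mono-≤ zero    f≤g = f≤g []
cubeSum-mono-≤ (suc n) f≤g = ℕ.+-mono-≤ (cubeSum-mono-≤ n (f≤g ∘ (false ∷_))) (cubeSum-mono-≤ n (f≤g ∘ (true ∷_)))

+-mono-≤-≡ : ∀ {a b c d} → a ≤ c → b ≤ d → a ℕ.+ b ≡ c ℕ.+ d → a ≡ c × b ≡ d
+-mono-≤-≡ {b = b} {c} {d} a≤c b≤d eq = a≡c , ℕ.+-cancelˡ-≡ c b d (trans (cong (ℕ._+ b) (sym a≡c)) eq)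
  where
  a≡c = ℕ.≤-antisym a≤c (ℕ.≮⇒≥ λ a<c → ℕ.<-irrefl eq (ℕ.+-mono-<-≤ a<c b≤d))

cubeSum-mono-≤-≡ : ∀ n {f g : Point n → ℕ} → (∀ x → f x ≤ g x) →
  ℕΣ.cubeSum n f ≡ ℕΣ.cubeSum n g → ∀ x → f x ≡ g x
cubeSum-mono-≤-≡ zero    f≤g eq [] = eq
cubeSum-mono-≤-≡ (suc n) f≤g eq (y ∷ x)
  with eq₀ , eq₁ ← +-mono-≤-≡ (cubeSum-mono-≤ n (f≤g ∘ (false ∷_))) (cubeSum-mono-≤ n (f≤g ∘ (true ∷_))) eq
  with y
... | false = cubeSum-mono-≤-≡ n (f≤g ∘ (false ∷_)) eq₀ x
... | true  = cubeSum-mono-≤-≡ n (f≤g ∘ (true ∷_)) eq₁ x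

coverCount : ∀ {n} → List (Face n) → Point n → ℕ
coverCount F x = ℕΣ.listSum F (λ b → indicator b x)

1≤coverCount : ∀ {n} {F : List (Face n)} {x} → Any (x ∈F_) F → 1 ≤ coverCount F x
1≤coverCount {F = b ∷ F} {x} (here x∈b)  = subst (λ c → 1 ≤ c ℕ.+ coverCount F x) (sym (∈F⇒indicator≡1 x b x∈b)) (s≤s z≤n)
1≤coverCount {F = b ∷ F} {x} (there x∈F) = ℕ.≤-trans (1≤coverCount x∈F) (ℕ.m≤n+m _ (indicator b x))

exactCover : ∀ {n} (F : List (Face n)) → (∀ x → Any (x ∈F_) F) →
  ℕΣ.listSum F (λ b → 2 ^ numStars b) ≡ 2 ^ n → ∀ x → coverCount F x ≡ 1
exactCover {n} F covers volume x =
  sym (cubeSum-mono-≤-≡ n (λ x → 1≤coverCount (covers x)) total x)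
  where
  open ≡-Reasoning
  total : ℕΣ.cubeSum n (const 1) ≡ ℕΣ.cubeSum n (coverCount F)
  total = begin
    ℕΣ.cubeSum n (const 1)                                  ≡⟨ ℕΣ.cubeSum-cong n (λ x → sym (∈F⇒indicator≡1 x (allStars n) (∈F-allStars x))) ⟩
    ℕΣ.cubeSum n (indicator (allStars n))                   ≡⟨ cubeSum-indicator n (allStars n) ⟩
    2 ^ numStars (allStars n)                               ≡⟨ cong (2 ^_) (numStars-allStars n) ⟩
    2 ^ n                                                   ≡⟨ sym volume ⟩
    ℕΣ.listSum F (λ b → 2 ^ numStars b)                     ≡⟨ ℕΣ.listSum-cong F (λ b → sym (cubeSum-indicator n b)) ⟩
    ℕΣ.listSum F (λ b → ℕΣ.cubeSum n (indicator b))         ≡⟨ sym (ℕΣ.cubeSum-listSum n F indicator) ⟩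
    ℕΣ.cubeSum n (coverCount F)                             ∎

-- Character sums over faces

sign : Maybe Bool → Bool → ℤ
sign nothing  _     = 1ℤ
sign (just _) false = 1ℤ
sign (just _) true  = -1ℤ

χ : ∀ {n} → Face n → Point n → ℤ
χ []      []      = 1ℤ
χ (m ∷ a) (y ∷ x) = sign m y ℤ.* χ a x

χ↾ : ∀ {n} → Face n → Face n → Point n → ℤ
χ↾ a b x = + indicator b x ℤ.* χ a x

charSum : ∀ {n} → Face n → Face n → ℤ
charSum {n} a b = ℤΣ.cubeSum n (χ↾ a b)

weight : Maybe Bool → Maybe Bool → ℤ
weight m m′ = + fits m′ false ℤ.* sign m false ℤ.+ + fits m′ true ℤ.* sign m true

charSum-∷ : ∀ {n} m m′ (a b : Face n) → charSum (m ∷ a) (m′ ∷ b) ≡ weight m m′ ℤ.* charSum a b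
charSum-∷ {n} m m′ a b = begin
  charSum (m ∷ a) (m′ ∷ b)
    ≡⟨ ℤΣ.cubeSum-cong (suc n) {f = χ↾ (m ∷ a) (m′ ∷ b)} {g = λ x → weightAt (head x) ℤ.* χ↾ a b (tail x)}
         (λ { (y ∷ x) → rearrange (fits m′ y) (indicator b x) (sign m y) (χ a x) }) ⟩
  ℤΣ.cubeSum (suc n) (λ x → weightAt (head x) ℤ.* χ↾ a b (tail x))
    ≡⟨ ℤΣ.cubeSum-head n weightAt (χ↾ a b) ⟩
  weight m m′ ℤ.* charSum a b
    ∎
  where
  open ≡-Reasoning
  open import Algebra.Properties.CommutativeSemigroup ℤ.*-commutativeSemigroup using (interchange)
  weightAt : Bool → ℤ
  weightAt y = + fits m′ y ℤ.* sign m y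
  rearrange : ∀ i j s t → + (i ℕ.* j) ℤ.* (s ℤ.* t) ≡ (+ i ℤ.* s) ℤ.* (+ j ℤ.* t)
  rearrange i j s t = trans (cong (ℤ._* (s ℤ.* t)) (ℤ.pos-* i j)) (interchange (+ i) (+ j) s t)

charSum-vanishes : ∀ {n} (a b : Face n) i {v} → lookup a i ≡ just v → lookup b i ≡ nothing → charSum a b ≡ 0ℤ
charSum-vanishes (just v ∷ a) (nothing ∷ b) zero    refl refl = charSum-∷ (just v) nothing a b
charSum-vanishes (m ∷ a)      (m′ ∷ b)      (suc i) a[i] b[i] = begin
  charSum (m ∷ a) (m′ ∷ b)     ≡⟨ charSum-∷ m m′ a b ⟩
  weight m m′ ℤ.* charSum a b  ≡⟨ cong (weight m m′ ℤ.*_) (charSum-vanishes a b i a[i] b[i]) ⟩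
  weight m m′ ℤ.* 0ℤ           ≡⟨ ℤ.*-zeroʳ (weight m m′) ⟩
  0ℤ                           ∎
  where open ≡-Reasoning

weight-self≢0 : ∀ m → weight m m ≢ 0ℤ
weight-self≢0 nothing      ()
weight-self≢0 (just false) ()
weight-self≢0 (just true)  ()

charSum-self≢0 : ∀ {n} (a : Face n) → charSum a a ≢ 0ℤ
charSum-self≢0 []      ()
charSum-self≢0 (m ∷ a) eq with ℤ.i*j≡0⇒i≡0∨j≡0 (weight m m) (trans (sym (charSum-∷ m m a a)) eq)
... | inj₁ weight≡0  = weight-self≢0 m weight≡0
... | inj₂ charSum≡0 = charSum-self≢0 a charSum≡0

listSum-pos-* : ∀ {A : Set} (xs : List A) (f : A → ℕ) s → ℤΣ.listSum xs (λ x → + f x ℤ.* s) ≡ + ℕΣ.listSum xs f ℤ.* s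
listSum-pos-* []       f s = refl
listSum-pos-* (x ∷ xs) f s = begin
  + f x ℤ.* s ℤ.+ ℤΣ.listSum xs (λ x → + f x ℤ.* s)  ≡⟨ cong (ℤ._+_ (+ f x ℤ.* s)) (listSum-pos-* xs f s) ⟩
  + f x ℤ.* s ℤ.+ + ℕΣ.listSum xs f ℤ.* s            ≡⟨ sym (ℤ.*-distribʳ-+ s (+ f x) (+ ℕΣ.listSum xs f)) ⟩
  (+ f x ℤ.+ + ℕΣ.listSum xs f) ℤ.* s                ≡⟨ cong (ℤ._* s) (sym (ℤ.pos-+ (f x) _)) ⟩
  + ℕΣ.listSum (x ∷ xs) f ℤ.* s                      ∎
  where open ≡-Reasoning

-- χ a sums to zero over the cube, and an exact cover splits that sum into its faces' sums.
charSum-exactCover : ∀ {n} (F : List (Face n)) → (∀ x → coverCount F x ≡ 1) →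
  ∀ a i {v} → lookup a i ≡ just v → ℤΣ.listSum F (charSum a) ≡ 0ℤ
charSum-exactCover {n} F exact a i a[i] = begin
  ℤΣ.listSum F (charSum a)
    ≡⟨ sym (ℤΣ.cubeSum-listSum n F (λ b → χ↾ a b)) ⟩
  ℤΣ.cubeSum n (λ x → ℤΣ.listSum F (λ b → χ↾ a b x))
    ≡⟨ ℤΣ.cubeSum-cong n {f = λ x → ℤΣ.listSum F (λ b → χ↾ a b x)} {g = χ↾ a (allStars n)}
         (λ x → trans (listSum-pos-* F (λ b → indicator b x) (χ a x)) (cong (λ c → + c ℤ.* χ a x) (once x))) ⟩
  charSum a (allStars n)
    ≡⟨ charSum-vanishes a (allStars n) i a[i] (Vec.lookup-replicate i nothing) ⟩
  0ℤ
    ∎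
  where
  open ≡-Reasoning
  once : ∀ x → coverCount F x ≡ indicator (allStars n) x
  once x = trans (exact x) (sym (∈F⇒indicator≡1 x (allStars n) (∈F-allStars x)))

listSum-two-valued : ∀ {A : Set} (t : A → ℤ) w (xs : List A) → All (λ x → t x ≡ 0ℤ ⊎ t x ≡ w) xs →
  ℤΣ.listSum xs t ≡ + length (filter (λ x → t x ℤ.≟ w) xs) ℤ.* w
listSum-two-valued t w []       []         = refl
listSum-two-valued t w (x ∷ xs) (tx ∷ txs) with t x ℤ.≟ w
... | yes tx≡w = begin
  t x ℤ.+ ℤΣ.listSum xs t     ≡⟨ cong₂ ℤ._+_ tx≡w (listSum-two-valued t w xs txs) ⟩
  w ℤ.+ + count ℤ.* w         ≡⟨ sym (ℤ.suc-* (+ count) w) ⟩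
  + suc count ℤ.* w           ∎
  where
  open ≡-Reasoning
  count = length (filter (λ x → t x ℤ.≟ w) xs)
... | no tx≢w = trans (cong₂ ℤ._+_ (tx≡0 tx) (listSum-two-valued t w xs txs)) (ℤ.+-identityˡ _)
  where
  tx≡0 : t x ≡ 0ℤ ⊎ t x ≡ w → t x ≡ 0ℤ
  tx≡0 (inj₁ tx≡0) = tx≡0
  tx≡0 (inj₂ tx≡w) = contradiction tx≡w tx≢w

pos*≢0 : ∀ {m w} → 0 < m → w ≢ 0ℤ → + m ℤ.* w ≢ 0ℤ
pos*≢0 {suc m} _ w≢0 eq with ℤ.i*j≡0⇒i≡0∨j≡0 (+ suc m) eq
... | inj₂ w≡0 = w≢0 w≡0

-- A face of a's dimension that is not parallel to a has a star at some fixed coordinate of a.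
opposite∈exactCover : ∀ {n d} (F : List (Face n)) → (∀ x → coverCount F x ≡ 1) → All (λ b → numStars b ≡ d) F →
  (∀ a b → a ∈L F → b ∈L F → a ≢ b → Parallel a b → Antipodal a b) →
  ∀ {a i v} → a ∈L F → lookup a i ≡ just v → opposite a ∈L F
opposite∈exactCover {n} F exact dims antipodal {a} {i} a∈F a[i] with Any.any? (opposite a ≟ᶠ_) F
... | yes ā∈F = ā∈F
... | no ā∉F = ⊥-elim (pos*≢0 (filter-some (λ b → charSum a b ℤ.≟ charSum a a) (lose a∈F refl)) (charSum-self≢0 a)
                 (trans (sym (listSum-two-valued (charSum a) (charSum a a) F (All.tabulate term)))
                        (charSum-exactCover F exact a i a[i])))
  where
  sameSize : ∀ {b} → b ∈L F → ∣ fixed a ∣ ≡ ∣ fixed b ∣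
  sameSize {b} b∈F = trans (∣fixed∣≡n∸numStars a)
    (trans (cong (n ∸_) (trans (All.lookup dims a∈F) (sym (All.lookup dims b∈F)))) (sym (∣fixed∣≡n∸numStars b)))
  term : ∀ {b} → b ∈L F → charSum a b ≡ 0ℤ ⊎ charSum a b ≡ charSum a a
  term {b} b∈F with a ≟ᶠ b
  ... | yes refl = inj₂ refl
  ... | no a≢b with fixed a ≟ˢ fixed b
  ...   | yes same = contradiction (subst (_∈L F) b≡ā b∈F) ā∉F
    where
    b≡ā = Antipodal⇒≡opposite (antipodal a b a∈F b∈F a≢b (Equivalence.from Parallel⇔fixed≡ same))
  ...   | no differ with j , j∈a , j∉b ← ∣p∣≡∣q∣⇒∃∈∉ (sameSize b∈F) differ with _ , a[j] ← ∈fixed⇒just j∈a =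
    inj₁ (charSum-vanishes a b j a[j] (∉fixed⇒nothing j∉b))

-- From a splitting to a non-colorable hypergraph

canonical : ∀ {n} → Face n → Bool
canonical []            = true
canonical (nothing ∷ a) = canonical a
canonical (just v ∷ a)  = not v

canonical-opposite : ∀ {n} (a : Face n) {i v} → lookup a i ≡ just v → canonical (opposite a) ≡ not (canonical a)
canonical-opposite (just _ ∷ a)  _          = refl
canonical-opposite (nothing ∷ a) {zero} ()
canonical-opposite (nothing ∷ a) {suc i} a[i] = canonical-opposite a a[i]

opposite-injective : ∀ {n} {a b : Face n} → opposite a ≡ opposite b → a ≡ b
opposite-injective {a = a} {b} eq = trans (sym (opposite-involutive a)) (trans (cong opposite eq) (opposite-involutive b))

length-filter+∁ : ∀ {A : Set} {P : A → Set} (P? : Decidable P) xs →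
  length (filter P? xs) ℕ.+ length (filter (∁? P?) xs) ≡ length xs
length-filter+∁ P? []       = refl
length-filter+∁ P? (x ∷ xs) with P? x
... | yes _ = cong suc (length-filter+∁ P? xs)
... | no _  = trans (ℕ.+-suc _ _) (cong suc (length-filter+∁ P? xs))

Unique-map⁺-injectiveOn : ∀ {A B : Set} {f : A → B} {xs} →
  (∀ {x y} → x ∈L xs → y ∈L xs → f x ≡ f y → x ≡ y) → Unique xs → Unique (List.map f xs)
Unique-map⁺-injectiveOn {xs = []}     _   []             = []
Unique-map⁺-injectiveOn {xs = x ∷ xs} inj (x∉xs ∷ uniq) =
  All.map⁺ (All.tabulate λ y∈ fx≡fy → All.lookup x∉xs y∈ (inj (here refl) (there y∈) fx≡fy))
  ∷ Unique-map⁺-injectiveOn (λ x∈ y∈ → inj (there x∈) (there y∈)) uniq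

listSum-const : ∀ {A : Set} (xs : List A) {f : A → ℕ} {c} → All (λ x → f x ≡ c) xs → ℕΣ.listSum xs f ≡ length xs ℕ.* c
listSum-const []       []           = refl
listSum-const (x ∷ xs) (fx≡c ∷ fxs) = cong₂ ℕ._+_ fx≡c (listSum-const xs fxs)

2^k≡2*2^[k∸1] : ∀ {k} → 1 ≤ k → 2 ^ k ≡ 2 ℕ.* 2 ^ (k ∸ 1)
2^k≡2*2^[k∸1] (s≤s z≤n) = refl

module FromSplitting {n k} (S : AntipodalSplitting n k) (1≤k : 1 ≤ k) (k≤n : k ≤ n) where

  open AntipodalSplitting S renaming (distinct to faces-distinct)
  open ≡-Reasoning

  exact : ∀ x → coverCount faces x ≡ 1
  exact = exactCover faces covers (begin
    ℕΣ.listSum faces (λ b → 2 ^ numStars b)  ≡⟨ listSum-const faces (All.map (cong (2 ^_)) dimension) ⟩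
    length faces ℕ.* 2 ^ (n ∸ k)             ≡⟨ cong (ℕ._* 2 ^ (n ∸ k)) count ⟩
    2 ^ k ℕ.* 2 ^ (n ∸ k)                    ≡⟨ sym (ℕ.^-distribˡ-+-* 2 k (n ∸ k)) ⟩
    2 ^ (k ℕ.+ (n ∸ k))                      ≡⟨ cong (2 ^_) (ℕ.m+[n∸m]≡n k≤n) ⟩
    2 ^ n                                    ∎)

  fixedCoordinate : ∀ {a} → a ∈L faces → ∃₂ λ i v → lookup a i ≡ just v
  fixedCoordinate {a} a∈ = numStars<n⇒just {a = a} (subst (_< n) (sym (All.lookup dimension a∈)) (ℕ.∸-monoʳ-< 1≤k k≤n))

  opposite∈faces : ∀ {a} → a ∈L faces → opposite a ∈L faces
  opposite∈faces a∈ with _ , _ , a[i] ← fixedCoordinate a∈ = opposite∈exactCover faces exact dimension antipodal a∈ a[i]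

  canonical-opposite∈ : ∀ {a} → a ∈L faces → canonical (opposite a) ≡ not (canonical a)
  canonical-opposite∈ {a} a∈ with _ , _ , a[i] ← fixedCoordinate a∈ = canonical-opposite a a[i]

  canonical? : Decidable {A = Face n} (λ a → canonical a ≡ true)
  canonical? a = canonical a Bool.≟ true

  representatives : List (Face n)
  representatives = filter canonical? faces

  others : List (Face n)
  others = filter (∁? canonical?) faces

  opposite-representatives : List.map opposite representatives ∼[ set ] others
  opposite-representatives = mk⇔ to from
    where
    to : ∀ {b} → b ∈L List.map opposite representatives → b ∈L others
    to b∈ with c , c∈ , b≡c̄ ← ∈-map⁻ opposite {xs = representatives} b∈
             with c∈F , c-canon ← ∈-filter⁻ canonical? {xs = faces} c∈ =
      subst (_∈L others) (sym b≡c̄) (∈-filter⁺ (∁? canonical?) (opposite∈faces c∈F)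
        (λ c̄-canon → case trans (sym c̄-canon) (trans (canonical-opposite∈ c∈F) (cong not c-canon)) of λ ()))
    from : ∀ {b} → b ∈L others → b ∈L List.map opposite representatives
    from {b} b∈ with b∈F , ¬b-canon ← ∈-filter⁻ (∁? canonical?) {xs = faces} b∈ =
      subst (_∈L List.map opposite representatives) (opposite-involutive b)
        (∈-map⁺ opposite (∈-filter⁺ canonical? (opposite∈faces b∈F)
          (trans (canonical-opposite∈ b∈F) (cong not (Bool.¬-not ¬b-canon)))))

  length-representatives : length representatives ≡ 2 ^ (k ∸ 1)
  length-representatives = ℕ.*-cancelˡ-≡ (length representatives) (2 ^ (k ∸ 1)) 2 (begin
    2 ℕ.* length representatives                         ≡⟨ cong (length representatives ℕ.+_) (ℕ.+-identityʳ _) ⟩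
    length representatives ℕ.+ length representatives    ≡⟨ cong (length representatives ℕ.+_) (sym length-others) ⟩
    length representatives ℕ.+ length others             ≡⟨ length-filter+∁ canonical? faces ⟩
    length faces                                         ≡⟨ count ⟩
    2 ^ k                                                ≡⟨ 2^k≡2*2^[k∸1] 1≤k ⟩
    2 ℕ.* 2 ^ (k ∸ 1)                                    ∎)
    where
    length-others : length others ≡ length representatives
    length-others = trans (sym (↭-length (∼bag⇒↭ (unique∧set⇒bag
      (Unique.map⁺ opposite-injective (filter⁺ canonical? faces-distinct))
      (filter⁺ (∁? canonical?) faces-distinct)
      opposite-representatives))))
      (length-map opposite representatives)

  fixed-injective : ∀ {c c′} → c ∈L representatives → c′ ∈L representatives → fixed c ≡ fixed c′ → c ≡ c′
  fixed-injective {c} {c′} c∈ c′∈ same with c ≟ᶠ c′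
  ... | yes c≡c′ = c≡c′
  ... | no c≢c′ with c∈F , c-canon ← ∈-filter⁻ canonical? {xs = faces} c∈
                   | c′∈F , c′-canon ← ∈-filter⁻ canonical? {xs = faces} c′∈ =
    case trans (sym c′-canon) (trans (cong canonical c′≡c̄) (trans (canonical-opposite∈ c∈F) (cong not c-canon))) of λ ()
    where
    c′≡c̄ : c′ ≡ opposite c
    c′≡c̄ = Antipodal⇒≡opposite (antipodal c c′ c∈F c′∈F c≢c′ (Equivalence.from (Parallel⇔fixed≡ {a = c} {c′}) same))

  hypergraph : UniformHypergraph n k
  hypergraph = record
    { edges    = List.map fixed representatives
    ; distinct = Unique-map⁺-injectiveOn fixed-injective (filter⁺ canonical? faces-distinct)
    ; uniform  = All.map⁺ (All.tabulate λ {c} c∈ →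
        trans (∣fixed∣≡n∸numStars c) (trans (cong (n ∸_) (All.lookup dimension (proj₁ (∈-filter⁻ canonical? {xs = faces} c∈))))
                                             (ℕ.m∸[m∸n]≡n k≤n)))
    }

  representativeOn : Subset n → Face n
  representativeOn e with Any.any? (λ c → fixed c ≟ˢ e) representatives
  ... | yes found = proj₁ (find found)
  ... | no _      = allStars n

  representativeOn-fixed : ∀ {c} → c ∈L representatives → representativeOn (fixed c) ≡ c
  representativeOn-fixed {c} c∈ with Any.any? (λ c′ → fixed c′ ≟ˢ fixed c) representatives
  ... | yes found = let _ , c′∈ , same = find found in fixed-injective c′∈ c∈ same
  ... | no none   = contradiction (lose c∈ refl) none

  Φ : Cover n
  Φ e = value (representativeOn e)

  notColorable : ¬ DP2Colorable hypergraph
  notColorable colorable with f , avoids ← colorable Φ with b , b∈F , fb∈b ← find (covers (tabulate f)) with canonical? b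
  ... | yes b-canon = AgreeOn⇒¬RestrDiffer agree (proj₁ (All.lookup avoids (∈-map⁺ fixed b∈)))
    where
    b∈ = ∈-filter⁺ canonical? b∈F b-canon
    agree : AgreeOn (fixed b) f (Φ (fixed b))
    agree {i} i∈b = trans (sym (Vec.lookup∘tabulate f i))
      (trans (∈F⇒AgreeOn {x = tabulate f} {b} fb∈b i∈b) (cong (λ c → value c i) (sym (representativeOn-fixed b∈))))
  ... | no ¬b-canon = AgreeOn⇒¬RestrDiffer agree (proj₂ (All.lookup avoids (∈-map⁺ fixed b̄∈)))
    where
    b̄∈ = ∈-filter⁺ canonical? (opposite∈faces b∈F) (trans (canonical-opposite∈ b∈F) (cong not (Bool.¬-not ¬b-canon)))
    agree : AgreeOn (fixed (opposite b)) f (not ∘ Φ (fixed (opposite b)))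
    agree {i} i∈b̄ = trans (sym (Vec.lookup∘tabulate f i))
      (trans (∈F⇒AgreeOn-opposite {x = tabulate f} {b} fb∈b i∈b̄) (cong (λ c → not (value c i)) (sym (representativeOn-fixed b̄∈))))

  nonColorable : ∃ λ (G : UniformHypergraph n k) → numEdges G ≡ 2 ^ (k ∸ 1) × ¬ DP2Colorable G
  nonColorable = hypergraph , trans (length-map fixed representatives) length-representatives , notColorable

fixed≡⊤ : ∀ {n} (a : Face n) → numStars a ≡ 0 → fixed a ≡ ⊤
fixed≡⊤ {n} a a₀ = ∣p∣≡n⇒p≡⊤ (trans (∣fixed∣≡n∸numStars a) (cong (n ∸_) a₀))

length≤2 : ∀ {n} (F : List (Face n)) → Unique F → All (λ a → numStars a ≡ 0) F →
  (∀ a b → a ∈L F → b ∈L F → a ≢ b → Parallel a b → Antipodal a b) → length F ≤ 2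
length≤2 []              _ _ _ = z≤n
length≤2 (_ ∷ [])        _ _ _ = s≤s z≤n
length≤2 (_ ∷ _ ∷ [])    _ _ _ = s≤s (s≤s z≤n)
length≤2 (a ∷ b ∷ c ∷ F) ((a≢b ∷ a≢c ∷ _) ∷ (b≢c ∷ _) ∷ _) (a₀ ∷ b₀ ∷ c₀ ∷ _) antipodal =
  contradiction (trans (≡opposite b₀ (there (here refl)) a≢b) (sym (≡opposite c₀ (there (there (here refl))) a≢c))) b≢c
  where
  ≡opposite : ∀ {d} → numStars d ≡ 0 → d ∈L (a ∷ b ∷ c ∷ F) → a ≢ d → d ≡ opposite a
  ≡opposite {d} d₀ d∈ a≢d = Antipodal⇒≡opposite (antipodal a d (here refl) d∈ a≢d
    (Equivalence.from Parallel⇔fixed≡ (trans (fixed≡⊤ a a₀) (sym (fixed≡⊤ d d₀)))))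

splitting⇒k≤n : ∀ {n k} → 1 ≤ n → AntipodalSplitting n k → k ≤ n
splitting⇒k≤n {n} {k} 1≤n S with k ℕ.≤? n
... | yes k≤n = k≤n
... | no k≰n  = contradiction (ℕ.≤-trans (s≤s (s≤s (s≤s z≤n))) 4≤length) (ℕ.≤⇒≯ length≤2-faces)
  where
  open AntipodalSplitting S
  n<k = ℕ.≰⇒> k≰n
  length≤2-faces : length faces ≤ 2
  length≤2-faces = length≤2 faces (AntipodalSplitting.distinct S)
    (All.map (λ d → trans d (ℕ.m≤n⇒m∸n≡0 (ℕ.<⇒≤ n<k))) dimension) antipodal
  4≤length : 2 ^ 2 ≤ length faces
  4≤length = subst (2 ^ 2 ≤_) (sym count) (ℕ.^-monoʳ-≤ 2 (ℕ.≤-trans (s≤s 1≤n) n<k))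

corollary2 : (n k : ℕ) → 1 ≤ n → 1 ≤ k →
    (∃ λ (G : UniformHypergraph n k) → numEdges G ≡ 2 ^ (k ∸ 1) × ¬ DP2Colorable G)
      ⇔ AntipodalSplitting n k
corollary2 n k 1≤n 1≤k = mk⇔ toSplitting toHypergraph
  where
  toSplitting : (∃ λ (G : UniformHypergraph n k) → numEdges G ≡ 2 ^ (k ∸ 1) × ¬ DP2Colorable G) → AntipodalSplitting n k
  toSplitting (G , size , ¬colorable) with Φ , blocked ← blockingCover G ¬colorable =
    splitting-of-blockingCover G 1≤k size Φ blocked
  toHypergraph : AntipodalSplitting n k → ∃ λ (G : UniformHypergraph n k) → numEdges G ≡ 2 ^ (k ∸ 1) × ¬ DP2Colorable G
  toHypergraph S = FromSplitting.nonColorable S 1≤k (splitting⇒k≤n 1≤n S)
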